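{- Let $(G_{2n})_{n\geq1}$ be the Genocchi numbers of the first kind, and let $t(m,j)$ and $T(n,j)$ be the central factorial numbers of the first and second kind, respectively. Then for all integers $m\geq 0$ and $n\geq 1$, \[ \sum_{j=0}^{m}(-1)^{m+j}t(m,j)G_{2n+2j}=m!\sum_{j=0}^n(-1)^{n+j}T(n,j)\,j!\,(j+m-1)!, \] where the term with $j=0$ on the right-hand side is taken to be $0$ (since $T(n,0)=0$ for $n\geq1$), so for $m=0$ no factor $(-1)!$ actually occurs.
   Context: The Genocchi numbers of the first kind are defined by $\frac{2t}{e^t+1}=t+\sum_{n\geq1}(-1)^nG_{2n}\frac{t^{2n}}{(2n)!}$. Stirling type numbers for a sequence $(a_n)_{n\geq1}$: $t(n+1,j)=t(n,j-1)-a_nt(n,j)$ and $T(n+1,j)=T(n,j-1)+a_jT(n,j)$, with $t(n,0)=T(n,0)=\delta_{n,0}$ and $t(n,j)=T(n,j)=0$ for $n<j$. The central factorial numbers are the case $a_n=n^2$. -}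

module Defs where

open import Data.Nat as ℕ using (ℕ; zero; suc)
open import Data.Nat.Combinatorics using (_C_)
open import Data.Integer using (ℤ; +_; _+_; _*_; -_; _-_)
open import Data.Bool using (if_then_else_)
open import Relation.Nullary.Decidable using (⌊_⌋)

sumTo : ℕ → (ℕ → ℤ) → ℤ
sumTo zero    f = f zero
sumTo (suc n) f = sumTo n f + f (suc n)

sumBelow : ℕ → (ℕ → ℤ) → ℤ
sumBelow zero    f = + 0
sumBelow (suc k) f = sumBelow k f + f k

sgn : ℕ → ℤ
sgn zero    = + 1
sgn (suc k) = - sgn k

δ₁ : ℕ → ℤ
δ₁ k = if ⌊ k ℕ.≟ 1 ⌋ then + 1 else + 0

-- g is the exponential generating function coefficient sequence of 2t/(e^t+1):
--   2t/(e^t+1) = Σ_k g k t^k/k!.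
-- Equivalently (e^t + 1) · Σ_k g k t^k/k! = 2t as formal power series, i.e.
-- comparing the coefficients of t^k/k!:
--   Σ_{i ≤ k} C(k,i) g i + g k = 2 δ_{k,1}.
IsGenocchiEGF : (ℕ → ℤ) → Set
IsGenocchiEGF g = ∀ k →
  sumTo k (λ i → + (k C i) * g i) + g k ≡ + 2 * δ₁ k
  where open import Relation.Binary.PropositionalEquality using (_≡_)

-- Genocchi numbers of the first kind from the EGF coefficients:
-- 2t/(e^t+1) = t + Σ_{n≥1} (-1)^n G_{2n} t^{2n}/(2n)!, so G_{2n} = (-1)^n g(2n).
-- `genocchi g m` denotes G_m (only used for even m = 2n).
genocchi : (ℕ → ℤ) → ℕ → ℤ
genocchi g m = sgn (m ℕ./ 2) * g m

a : ℕ → ℤ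
a n = + (n ℕ.* n)

tc : ℕ → ℕ → ℤ
tc zero    zero    = + 1
tc zero    (suc j) = + 0
tc (suc n) zero    = + 0
tc (suc n) (suc j) = tc n j - a n * tc n (suc j)

Tc : ℕ → ℕ → ℤ
Tc zero    zero    = + 1
Tc zero    (suc j) = + 0
Tc (suc n) zero    = + 0
Tc (suc n) (suc j) = Tc n j + a (suc j) * Tc n (suc j)

module Submission where

-- Both sides, as functions of (m, n) with the sign (−1)^(m+n) removed, satisfy
-- f (m, n + 1) = f (m + 1, n) + m² f (m, n): on the Genocchi side this is the recurrence of t, on
-- the factorial side that of T together with (m − j) (j + m)! = (m² − j²) (j + m − 1)!.  So it
-- suffices to compare them at n = 0, m ≥ 1, i.e. to show Σ_j t(m,j) g(2j) = (−1)^m m! (m − 1)!.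
-- Let L be the linear functional X^r ↦ g r; the EGF of g says L (q (X + 1)) + L q = 2 q'(0).
-- The left side is L P for P = ∏_{k<m} (X² − k²), and 2 P = F + F (X + 1) for
-- F = ∏_{k<m} (X + k) (X − k − 1), so it equals F'(0) = (−1)^m m! (m − 1)!.

open import Defs
open import Data.Nat using (ℕ; _∸_; _≤_; _!) renaming (_+_ to _+ℕ_; _*_ to _*ℕ_)
open import Data.Integer using (ℤ; +_; _*_)
open import Relation.Binary.PropositionalEquality using (_≡_)

open import Data.Nat using (zero; suc; _<_; z≤n; s≤s)
open import Data.Sum using (inj₁; inj₂)
import Data.Nat.Properties as ℕ
import Data.Nat.Tactic.RingSolver as ℕ-Ring
open import Data.Nat.DivMod using (_/_; m*n/n≡m)
open import Data.Nat.Combinatorics using (_C_; k>n⇒nCk≡0; nCk+nC[k+1]≡[n+1]C[k+1])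
open import Data.Integer using (_+_; -_; _-_)
import Data.Integer.Properties as ℤ
open import Data.Integer.Tactic.RingSolver using (solve-∀)
open import Function using (_∘_)
open import Relation.Binary.PropositionalEquality
  using (refl; sym; trans; cong; cong₂; subst; _≗_; module ≡-Reasoning)

open ≡-Reasoning

sumTo-cong-≤ : ∀ n {f h : ℕ → ℤ} → (∀ j → j ≤ n → f j ≡ h j) → sumTo n f ≡ sumTo n h
sumTo-cong-≤ zero    f≡h = f≡h 0 z≤n
sumTo-cong-≤ (suc n) f≡h =
  cong₂ _+_ (sumTo-cong-≤ n (λ j j≤n → f≡h j (ℕ.m≤n⇒m≤1+n j≤n))) (f≡h (suc n) ℕ.≤-refl)

sumTo-cong : ∀ n {f h : ℕ → ℤ} → f ≗ h → sumTo n f ≡ sumTo n h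
sumTo-cong n f≗h = sumTo-cong-≤ n (λ j _ → f≗h j)

+-interchange : ∀ w x y z → w + x + (y + z) ≡ w + y + (x + z)
+-interchange = solve-∀

sumTo-+ : ∀ n (f h : ℕ → ℤ) → sumTo n (λ j → f j + h j) ≡ sumTo n f + sumTo n h
sumTo-+ zero    f h = refl
sumTo-+ (suc n) f h =
  trans (cong (_+ (f (suc n) + h (suc n))) (sumTo-+ n f h))
        (+-interchange (sumTo n f) (sumTo n h) (f (suc n)) (h (suc n)))

sumTo-*ˡ : ∀ n c (f : ℕ → ℤ) → sumTo n (λ j → c * f j) ≡ c * sumTo n f
sumTo-*ˡ zero    c f = refl
sumTo-*ˡ (suc n) c f =
  trans (cong (_+ c * f (suc n)) (sumTo-*ˡ n c f)) (sym (ℤ.*-distribˡ-+ c (sumTo n f) (f (suc n))))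

sumTo-*ʳ : ∀ n c (f : ℕ → ℤ) → sumTo n (λ j → f j * c) ≡ sumTo n f * c
sumTo-*ʳ zero    c f = refl
sumTo-*ʳ (suc n) c f =
  trans (cong (_+ f (suc n) * c) (sumTo-*ʳ n c f)) (sym (ℤ.*-distribʳ-+ c (sumTo n f) (f (suc n))))

sumTo-unfoldˡ : ∀ n (f : ℕ → ℤ) → sumTo (suc n) f ≡ f 0 + sumTo n (f ∘ suc)
sumTo-unfoldˡ zero    f = refl
sumTo-unfoldˡ (suc n) f =
  trans (cong (_+ f (suc (suc n))) (sumTo-unfoldˡ n f)) (ℤ.+-assoc (f 0) _ _)

sumTo-comm : ∀ n m (h : ℕ → ℕ → ℤ) →
  sumTo n (λ i → sumTo m (h i)) ≡ sumTo m (λ r → sumTo n (λ i → h i r))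
sumTo-comm zero    m h = refl
sumTo-comm (suc n) m h =
  trans (cong (_+ sumTo m (h (suc n))) (sumTo-comm n m h))
        (sym (sumTo-+ m (λ r → sumTo n (λ i → h i r)) (h (suc n))))

sumTo-zero : ∀ n {f : ℕ → ℤ} → (∀ j → f j ≡ + 0) → sumTo n f ≡ + 0
sumTo-zero zero    f≡0 = f≡0 0
sumTo-zero (suc n) f≡0 = cong₂ _+_ (sumTo-zero n f≡0) (f≡0 (suc n))

sumTo-extend : ∀ n D (f : ℕ → ℤ) → n ≤ D → (∀ j → n < j → f j ≡ + 0) → sumTo D f ≡ sumTo n f
sumTo-extend n zero    f z≤n f≡0 = refl
sumTo-extend n (suc D) f n≤1+D f≡0 with ℕ.m≤n⇒m<n∨m≡n n≤1+D
... | inj₂ refl = refl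
... | inj₁ n<1+D =
  trans (cong₂ _+_ (sumTo-extend n D f (ℕ.≤-pred n<1+D) f≡0) (f≡0 (suc D) n<1+D))
        (ℤ.+-identityʳ _)

sumTo-∘suc : ∀ n (f : ℕ → ℤ) → f 0 ≡ + 0 → f (suc n) ≡ + 0 → sumTo n (f ∘ suc) ≡ sumTo n f
sumTo-∘suc n f f0≡0 f[1+n]≡0 = begin
  sumTo n (f ∘ suc)             ≡⟨ ℤ.+-identityˡ _ ⟨
  + 0 + sumTo n (f ∘ suc)       ≡⟨ cong (_+ sumTo n (f ∘ suc)) f0≡0 ⟨
  f 0 + sumTo n (f ∘ suc)       ≡⟨ sumTo-unfoldˡ n f ⟨
  sumTo n f + f (suc n)         ≡⟨ cong (λ x → sumTo n f + x) f[1+n]≡0 ⟩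
  sumTo n f + + 0               ≡⟨ ℤ.+-identityʳ _ ⟩
  sumTo n f                     ∎

sumTo-even+odd : ∀ k (f : ℕ → ℤ) →
  sumTo (suc (2 *ℕ k)) f ≡ sumTo k (λ j → f (2 *ℕ j)) + sumTo k (λ j → f (suc (2 *ℕ j)))
sumTo-even+odd zero    f = refl
sumTo-even+odd (suc k) f = begin
  sumTo (suc (2 *ℕ suc k)) f
    ≡⟨ cong (λ i → sumTo (suc i) f) 2[1+k]≡2+2k ⟩
  sumTo (suc (2 *ℕ k)) f + f (2 +ℕ 2 *ℕ k) + f (3 +ℕ 2 *ℕ k)
    ≡⟨ cong (λ s → s + f (2 +ℕ 2 *ℕ k) + f (3 +ℕ 2 *ℕ k)) (sumTo-even+odd k f) ⟩
  evens + odds + f (2 +ℕ 2 *ℕ k) + f (3 +ℕ 2 *ℕ k)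
    ≡⟨ ℤ.+-assoc (evens + odds) _ _ ⟩
  evens + odds + (f (2 +ℕ 2 *ℕ k) + f (3 +ℕ 2 *ℕ k))
    ≡⟨ +-interchange evens odds _ _ ⟩
  evens + f (2 +ℕ 2 *ℕ k) + (odds + f (3 +ℕ 2 *ℕ k))
    ≡⟨ cong (λ i → evens + f i + (odds + f (suc i))) 2[1+k]≡2+2k ⟨
  sumTo (suc k) (λ j → f (2 *ℕ j)) + sumTo (suc k) (λ j → f (suc (2 *ℕ j)))
    ∎
  where
  2[1+k]≡2+2k : 2 *ℕ suc k ≡ 2 +ℕ 2 *ℕ k
  2[1+k]≡2+2k = ℕ.*-suc 2 k
  evens odds : ℤ
  evens = sumTo k (λ j → f (2 *ℕ j))
  odds  = sumTo k (λ j → f (suc (2 *ℕ j)))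

sgn-+ : ∀ m n → sgn (m +ℕ n) ≡ sgn m * sgn n
sgn-+ zero    n = sym (ℤ.*-identityˡ (sgn n))
sgn-+ (suc m) n = trans (cong -_ (sgn-+ m n)) (ℤ.neg-distribˡ-* (sgn m) (sgn n))

sgn-*-sgn : ∀ n → sgn n * sgn n ≡ + 1
sgn-*-sgn zero    = refl
sgn-*-sgn (suc n) = trans (neg-*-neg (sgn n)) (sgn-*-sgn n)
  where
  neg-*-neg : ∀ x → - x * - x ≡ x * x
  neg-*-neg = solve-∀

sgn-+-*-sgn-+ : ∀ k m n → sgn (k +ℕ m) * sgn (k +ℕ n) ≡ sgn (m +ℕ n)
sgn-+-*-sgn-+ k m n = begin
  sgn (k +ℕ m) * sgn (k +ℕ n)          ≡⟨ cong₂ _*_ (sgn-+ k m) (sgn-+ k n) ⟩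
  sgn k * sgn m * (sgn k * sgn n)      ≡⟨ regroup (sgn k) (sgn m) (sgn n) ⟩
  sgn k * sgn k * (sgn m * sgn n)      ≡⟨ cong (_* (sgn m * sgn n)) (sgn-*-sgn k) ⟩
  + 1 * (sgn m * sgn n)                ≡⟨ ℤ.*-identityˡ _ ⟩
  sgn m * sgn n                        ≡⟨ sgn-+ m n ⟨
  sgn (m +ℕ n)                         ∎
  where
  regroup : ∀ x y z → x * y * (x * z) ≡ x * x * (y * z)
  regroup = solve-∀

Poly : Set
Poly = ℕ → ℤ

dot : ℕ → Poly → (ℕ → ℤ) → ℤ
dot D q w = sumTo D (λ r → q r * w r)

dot-congˡ : ∀ D {q q' : Poly} (w : ℕ → ℤ) → q ≗ q' → dot D q w ≡ dot D q' w
dot-congˡ D w q≗q' = sumTo-cong D (λ r → cong (_* w r) (q≗q' r))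

dot-congʳ : ∀ D (q : Poly) {w w' : ℕ → ℤ} → w ≗ w' → dot D q w ≡ dot D q w'
dot-congʳ D q w≗w' = sumTo-cong D (λ r → cong (q r *_) (w≗w' r))

dot-+ˡ : ∀ D (q q' : Poly) w → dot D (λ r → q r + q' r) w ≡ dot D q w + dot D q' w
dot-+ˡ D q q' w = trans (sumTo-cong D (λ r → ℤ.*-distribʳ-+ (w r) (q r) (q' r))) (sumTo-+ D _ _)

dot-+ʳ : ∀ D (q : Poly) w w' → dot D q (λ r → w r + w' r) ≡ dot D q w + dot D q w'
dot-+ʳ D q w w' = trans (sumTo-cong D (λ r → ℤ.*-distribˡ-+ (q r) (w r) (w' r))) (sumTo-+ D _ _)

dot-*ˡ : ∀ D c (q : Poly) w → dot D (λ r → c * q r) w ≡ c * dot D q w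
dot-*ˡ D c q w = trans (sumTo-cong D (λ r → ℤ.*-assoc c (q r) (w r))) (sumTo-*ˡ D c _)

dot-*ʳ : ∀ D c (q : Poly) w → dot D q (λ r → c * w r) ≡ c * dot D q w
dot-*ʳ D c q w = trans (sumTo-cong D (λ r → swap-factor (q r) c (w r))) (sumTo-*ˡ D c _)
  where
  swap-factor : ∀ x y z → x * (y * z) ≡ y * (x * z)
  swap-factor = solve-∀

mulX : Poly → Poly
mulX q zero    = + 0
mulX q (suc r) = q r

mulX+ : ℤ → Poly → Poly
mulX+ c q r = mulX q r + c * q r

1ₚ : Poly
1ₚ zero    = + 1
1ₚ (suc r) = + 0

DegreeAtMost : ℕ → Poly → Set
DegreeAtMost d q = ∀ r → d < r → q r ≡ + 0

mulX+-degree : ∀ {d} c {q} → DegreeAtMost d q → DegreeAtMost (suc d) (mulX+ c q)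
mulX+-degree {d} c {q} deg (suc r) (s≤s d<r) =
  trans (cong₂ (λ x y → x + c * y) (deg r d<r) (deg (suc r) (ℕ.m<n⇒m<1+n d<r)))
        (trans (ℤ.+-identityˡ (c * + 0)) (ℤ.*-zeroʳ c))

mulX+-cong : ∀ c {q q' : Poly} → q ≗ q' → mulX+ c q ≗ mulX+ c q'
mulX+-cong c q≗q' zero    = cong (λ x → + 0 + c * x) (q≗q' 0)
mulX+-cong c q≗q' (suc r) = cong₂ (λ x y → x + c * y) (q≗q' r) (q≗q' (suc r))

mulX+-mulX+ : ∀ b c q r →
  mulX+ b (mulX+ c q) r ≡ mulX (mulX q) r + (b + c) * mulX q r + b * c * q r
mulX+-mulX+ b c q zero          = expand₀ (q 0) b c
  where
  expand₀ : ∀ x b c → + 0 + b * (+ 0 + c * x) ≡ + 0 + (b + c) * + 0 + b * c * x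
  expand₀ = solve-∀
mulX+-mulX+ b c q (suc zero)    = expand₁ (q 0) (q 1) b c
  where
  expand₁ : ∀ x y b c → + 0 + c * x + b * (x + c * y) ≡ + 0 + (b + c) * x + b * c * y
  expand₁ = solve-∀
mulX+-mulX+ b c q (suc (suc r)) = expand (q r) (q (suc r)) (q (suc (suc r))) b c
  where
  expand : ∀ x y z b c → x + c * y + b * (y + c * z) ≡ x + (b + c) * y + b * c * z
  expand = solve-∀

mulX+-comm : ∀ b c q → mulX+ b (mulX+ c q) ≗ mulX+ c (mulX+ b q)
mulX+-comm b c q r = begin
  mulX+ b (mulX+ c q) r
    ≡⟨ mulX+-mulX+ b c q r ⟩
  mulX (mulX q) r + (b + c) * mulX q r + b * c * q r
    ≡⟨ cong₂ (λ s p → mulX (mulX q) r + s * mulX q r + p * q r) (ℤ.+-comm b c) (ℤ.*-comm b c) ⟩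
  mulX (mulX q) r + (c + b) * mulX q r + c * b * q r
    ≡⟨ mulX+-mulX+ c b q r ⟨
  mulX+ c (mulX+ b q) r
    ∎

mulX+-mulX+-neg : ∀ n q r → mulX+ (+ n) (mulX+ (- + n) q) r ≡ mulX (mulX q) r - a n * q r
mulX+-mulX+-neg n q r = begin
  mulX+ (+ n) (mulX+ (- + n) q) r
    ≡⟨ mulX+-mulX+ (+ n) (- + n) q r ⟩
  mulX (mulX q) r + (+ n - + n) * mulX q r + + n * - + n * q r
    ≡⟨ cancel (mulX (mulX q) r) (mulX q r) (q r) (+ n) ⟩
  mulX (mulX q) r - + n * + n * q r
    ≡⟨ cong (λ x → mulX (mulX q) r - x * q r) (ℤ.pos-* n n) ⟨
  mulX (mulX q) r - a n * q r
    ∎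
  where
  cancel : ∀ x y z c → x + (c - c) * y + c * - c * z ≡ x - c * c * z
  cancel = solve-∀

mulX+-neg-+-mulX+ : ∀ c q r → mulX+ (- c) q r + mulX+ c q r ≡ + 2 * mulX+ (+ 0) q r
mulX+-neg-+-mulX+ c q r = average (mulX q r) (q r) c
  where
  average : ∀ x y c → x + - c * y + (x + c * y) ≡ + 2 * (x + + 0 * y)
  average = solve-∀

dot-top : ∀ E (q : Poly) w → q (suc E) ≡ + 0 → dot (suc E) q w ≡ dot E q w
dot-top E q w q[1+E]≡0 =
  trans (cong (λ x → dot E q w + x * w (suc E)) q[1+E]≡0) (ℤ.+-identityʳ (dot E q w))

-- When deg q ≤ D, shift D q is the coefficient sequence of q (X + 1).
shift : ℕ → Poly → Poly
shift D q i = dot D q (λ r → + (r C i))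

shift-mulX : ∀ E q → q (suc E) ≡ + 0 →
  ∀ i → shift (suc E) (mulX q) i ≡ mulX (shift (suc E) q) i + shift (suc E) q i
shift-mulX E q q[1+E]≡0 zero = begin
  shift (suc E) (mulX q) 0    ≡⟨ sumTo-unfoldˡ E _ ⟩
  + 0 + shift E q 0           ≡⟨ ℤ.+-identityˡ _ ⟩
  shift E q 0                 ≡⟨ dot-top E q _ q[1+E]≡0 ⟨
  shift (suc E) q 0           ≡⟨ ℤ.+-identityˡ _ ⟨
  + 0 + shift (suc E) q 0     ∎
shift-mulX E q q[1+E]≡0 (suc i) = begin
  shift (suc E) (mulX q) (suc i)
    ≡⟨ sumTo-unfoldˡ E _ ⟩
  + 0 + dot E q (λ r → + (suc r C suc i))
    ≡⟨ ℤ.+-identityˡ _ ⟩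
  dot E q (λ r → + (suc r C suc i))
    ≡⟨ dot-congʳ E q pascal ⟩
  dot E q (λ r → + (r C i) + + (r C suc i))
    ≡⟨ dot-+ʳ E q _ _ ⟩
  shift E q i + shift E q (suc i)
    ≡⟨ cong₂ _+_ (dot-top E q _ q[1+E]≡0) (dot-top E q _ q[1+E]≡0) ⟨
  shift (suc E) q i + shift (suc E) q (suc i)
    ∎
  where
  pascal : ∀ r → + (suc r C suc i) ≡ + (r C i) + + (r C suc i)
  pascal r = trans (cong +_ (sym (nCk+nC[k+1]≡[n+1]C[k+1] r i))) (ℤ.pos-+ (r C i) (r C suc i))

shift-mulX+ : ∀ E c q → q (suc E) ≡ + 0 →
  shift (suc E) (mulX+ c q) ≗ mulX+ (c + + 1) (shift (suc E) q)
shift-mulX+ E c q q[1+E]≡0 i = begin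
  shift D (mulX+ c q) i
    ≡⟨ dot-+ˡ D (mulX q) _ _ ⟩
  shift D (mulX q) i + dot D (λ r → c * q r) _
    ≡⟨ cong₂ _+_ (shift-mulX E q q[1+E]≡0 i) (dot-*ˡ D c q _) ⟩
  mulX (shift D q) i + shift D q i + c * shift D q i
    ≡⟨ collect (mulX (shift D q) i) (shift D q i) c ⟩
  mulX+ (c + + 1) (shift D q) i
    ∎
  where
  D : ℕ
  D = suc E
  collect : ∀ x y c → x + y + c * y ≡ x + (c + + 1) * y
  collect = solve-∀

dot-shift : ∀ D q (g : ℕ → ℤ) →
  dot D (shift D q) g ≡ dot D q (λ r → sumTo r (λ i → + (r C i) * g i))
dot-shift D q g = begin
  sumTo D (λ i → sumTo D (λ r → q r * + (r C i)) * g i)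
    ≡⟨ sumTo-cong D (λ i → sumTo-*ʳ D (g i) _) ⟨
  sumTo D (λ i → sumTo D (λ r → q r * + (r C i) * g i))
    ≡⟨ sumTo-comm D D _ ⟩
  sumTo D (λ r → sumTo D (λ i → q r * + (r C i) * g i))
    ≡⟨ sumTo-cong-≤ D inner ⟩
  dot D q (λ r → sumTo r (λ i → + (r C i) * g i))
    ∎
  where
  inner : ∀ r → r ≤ D →
    sumTo D (λ i → q r * + (r C i) * g i) ≡ q r * sumTo r (λ i → + (r C i) * g i)
  inner r r≤D = begin
    sumTo D (λ i → q r * + (r C i) * g i)    ≡⟨ sumTo-cong D (λ i → ℤ.*-assoc (q r) _ (g i)) ⟩
    sumTo D (λ i → q r * (+ (r C i) * g i))  ≡⟨ sumTo-*ˡ D (q r) _ ⟩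
    q r * sumTo D (λ i → + (r C i) * g i)    ≡⟨ cong (q r *_) (sumTo-extend r D _ r≤D
                                                  (λ i r<i → cong (λ x → + x * g i) (k>n⇒nCk≡0 r<i))) ⟩
    q r * sumTo r (λ i → + (r C i) * g i)    ∎

dot-shift-+-dot : ∀ g → IsGenocchiEGF g →
  ∀ E q → dot (suc E) (shift (suc E) q) g + dot (suc E) q g ≡ + 2 * q 1
dot-shift-+-dot g egf E q = begin
  dot D (shift D q) g + dot D q g
    ≡⟨ cong (_+ dot D q g) (dot-shift D q g) ⟩
  dot D q (λ r → sumTo r (λ i → + (r C i) * g i)) + dot D q g
    ≡⟨ dot-+ʳ D q _ g ⟨
  dot D q (λ r → sumTo r (λ i → + (r C i) * g i) + g r)
    ≡⟨ dot-congʳ D q egf ⟩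
  dot D q (λ r → + 2 * δ₁ r)
    ≡⟨ sumTo-extend 1 D _ (s≤s z≤n) above-1 ⟩
  q 0 * (+ 2 * + 0) + q 1 * (+ 2 * + 1)
    ≡⟨ simplify (q 0) (q 1) ⟩
  + 2 * q 1
    ∎
  where
  D : ℕ
  D = suc E
  above-1 : ∀ j → 1 < j → q j * (+ 2 * δ₁ j) ≡ + 0
  above-1 (suc zero)    (s≤s ())
  above-1 (suc (suc j)) _ = ℤ.*-zeroʳ (q (suc (suc j)))
  simplify : ∀ x y → x * (+ 2 * + 0) + y * (+ 2 * + 1) ≡ + 2 * y
  simplify = solve-∀

shift-1ₚ : ∀ D → shift D 1ₚ ≗ 1ₚ
shift-1ₚ zero    zero    = refl
shift-1ₚ zero    (suc i) = refl
shift-1ₚ (suc D) i       = trans (ℤ.+-identityʳ (shift D 1ₚ i)) (shift-1ₚ D i)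

-- cf m = ∏_{k<m} (X + k)(X − k) = Σ_j t(m,j) X^(2j).  Replacing its factor X by X − m or X + m
-- gives cf⁻ m and cf⁺ m = cf⁻ m (X + 1); cf/X k = cf (k + 1) / X.
cf : ℕ → Poly
cf zero    = 1ₚ
cf (suc k) = mulX+ (+ k) (mulX+ (- + k) (cf k))

cf⁻ : ℕ → Poly
cf⁻ zero    = 1ₚ
cf⁻ (suc k) = mulX+ (+ k) (mulX+ (- + suc k) (cf⁻ k))

cf⁺ : ℕ → Poly
cf⁺ zero    = 1ₚ
cf⁺ (suc k) = mulX+ (+ suc k) (mulX+ (- + k) (cf⁺ k))

cf/X : ℕ → Poly
cf/X zero    = mulX+ (+ 0) 1ₚ
cf/X (suc k) = mulX+ (+ suc k) (mulX+ (- + suc k) (cf/X k))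

cf-suc : ∀ k → cf (suc k) ≗ mulX+ (+ 0) (cf/X k)
cf-suc zero    r = refl
cf-suc (suc k) r =
  trans (mulX+-cong (+ suc k) (λ r' → trans (mulX+-cong (- + suc k) (cf-suc k) r')
                                            (mulX+-comm (- + suc k) (+ 0) _ r')) r)
        (mulX+-comm (+ suc k) (+ 0) _ r)

cf⁻-suc : ∀ k → cf⁻ (suc k) ≗ mulX+ (- + suc k) (cf/X k)
cf⁻-suc zero    r = mulX+-comm (+ 0) (- + 1) 1ₚ r
cf⁻-suc (suc k) r =
  trans (mulX+-cong (+ suc k) (mulX+-cong (- + suc (suc k)) (cf⁻-suc k)) r)
        (mulX+-comm (+ suc k) (- + suc (suc k)) _ r)

cf⁺-suc : ∀ k → cf⁺ (suc k) ≗ mulX+ (+ suc k) (cf/X k)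
cf⁺-suc zero    r = refl
cf⁺-suc (suc k) r =
  mulX+-cong (+ suc (suc k)) (λ r' → trans (mulX+-cong (- + suc k) (cf⁺-suc k) r')
                                           (mulX+-comm (- + suc k) (+ suc k) _ r')) r

cf⁻-+-cf⁺ : ∀ m r → cf⁻ m r + cf⁺ m r ≡ + 2 * cf m r
cf⁻-+-cf⁺ zero    zero    = refl
cf⁻-+-cf⁺ zero    (suc r) = refl
cf⁻-+-cf⁺ (suc k) r = begin
  cf⁻ (suc k) r + cf⁺ (suc k) r
    ≡⟨ cong₂ _+_ (cf⁻-suc k r) (cf⁺-suc k r) ⟩
  mulX+ (- + suc k) (cf/X k) r + mulX+ (+ suc k) (cf/X k) r
    ≡⟨ mulX+-neg-+-mulX+ (+ suc k) (cf/X k) r ⟩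
  + 2 * mulX+ (+ 0) (cf/X k) r
    ≡⟨ cong (+ 2 *_) (cf-suc k r) ⟨
  + 2 * cf (suc k) r
    ∎

cf⁻-degree : ∀ k → DegreeAtMost (2 *ℕ k) (cf⁻ k)
cf⁻-degree zero    (suc r) _ = refl
cf⁻-degree (suc k) = subst (λ d → DegreeAtMost d (cf⁻ (suc k))) (sym (ℕ.*-suc 2 k))
                           (mulX+-degree (+ k) (mulX+-degree (- + suc k) (cf⁻-degree k)))

shift-cf⁻ : ∀ E k → 2 *ℕ k ≤ E → shift (suc E) (cf⁻ k) ≗ cf⁺ k
shift-cf⁻ E zero    _   = shift-1ₚ (suc E)
shift-cf⁻ E (suc k) 2[1+k]≤E i = begin
  shift D (mulX+ (+ k) (mulX+ (- + suc k) (cf⁻ k))) i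
    ≡⟨ shift-mulX+ E (+ k) _ inner-vanishes i ⟩
  mulX+ (+ k + + 1) (shift D (mulX+ (- + suc k) (cf⁻ k))) i
    ≡⟨ mulX+-cong (+ k + + 1) (shift-mulX+ E (- + suc k) (cf⁻ k) cf⁻-vanishes) i ⟩
  mulX+ (+ k + + 1) (mulX+ (- + suc k + + 1) (shift D (cf⁻ k))) i
    ≡⟨ mulX+-cong (+ k + + 1) (mulX+-cong (- + suc k + + 1) (shift-cf⁻ E k 2k≤E)) i ⟩
  mulX+ (+ k + + 1) (mulX+ (- + suc k + + 1) (cf⁺ k)) i
    ≡⟨ cong₂ (λ b c → mulX+ b (mulX+ c (cf⁺ k)) i) +k+1≡+[1+k] -[1+k]+1≡-k ⟩
  cf⁺ (suc k) i
    ∎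
  where
  D : ℕ
  D = suc E
  2+2k≤E : 2 +ℕ 2 *ℕ k ≤ E
  2+2k≤E = ℕ.≤-trans (ℕ.≤-reflexive (sym (ℕ.*-suc 2 k))) 2[1+k]≤E
  2k≤E : 2 *ℕ k ≤ E
  2k≤E = ℕ.≤-trans (ℕ.m≤n+m (2 *ℕ k) 2) 2+2k≤E
  inner-vanishes : mulX+ (- + suc k) (cf⁻ k) (suc E) ≡ + 0
  inner-vanishes = mulX+-degree (- + suc k) (cf⁻-degree k) (suc E) (ℕ.m≤n⇒m≤1+n 2+2k≤E)
  cf⁻-vanishes : cf⁻ k (suc E) ≡ + 0
  cf⁻-vanishes = cf⁻-degree k (suc E) (s≤s 2k≤E)
  +k+1≡+[1+k] : + k + + 1 ≡ + suc k
  +k+1≡+[1+k] = trans (sym (ℤ.pos-+ k 1)) (cong +_ (ℕ.+-comm k 1))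
  -[1+k]+1≡-k : - + suc k + + 1 ≡ - + k
  -[1+k]+1≡-k = trans (cong (λ x → - x + + 1) (ℤ.pos-+ 1 k)) (cancel (+ k))
    where
    cancel : ∀ x → - (+ 1 + x) + + 1 ≡ - x
    cancel = solve-∀

a-*-tc-zero : ∀ m → a m * tc m 0 ≡ + 0
a-*-tc-zero zero    = refl
a-*-tc-zero (suc m) = ℤ.*-zeroʳ (a (suc m))

cf-odd : ∀ k j → cf k (suc (2 *ℕ j)) ≡ + 0
cf-odd zero    j = refl
cf-odd (suc k) j = begin
  cf (suc k) (suc (2 *ℕ j))
    ≡⟨ mulX+-mulX+-neg k (cf k) (suc (2 *ℕ j)) ⟩
  mulX (mulX (cf k)) (suc (2 *ℕ j)) - a k * cf k (suc (2 *ℕ j))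
    ≡⟨ cong₂ (λ x y → x - a k * y) (X²-odd j) (cf-odd k j) ⟩
  + 0 - a k * + 0
    ≡⟨ cong (λ x → + 0 - x) (ℤ.*-zeroʳ (a k)) ⟩
  + 0
    ∎
  where
  X²-odd : ∀ j → mulX (mulX (cf k)) (suc (2 *ℕ j)) ≡ + 0
  X²-odd zero    = refl
  X²-odd (suc j) = trans (cong (λ i → mulX (mulX (cf k)) (suc i)) (ℕ.*-suc 2 j)) (cf-odd k j)

cf-even : ∀ k j → cf k (2 *ℕ j) ≡ tc k j
cf-even zero    zero    = refl
cf-even zero    (suc j) = refl
cf-even (suc k) zero    = begin
  cf (suc k) 0                ≡⟨ mulX+-mulX+-neg k (cf k) 0 ⟩
  + 0 - a k * cf k 0          ≡⟨ cong (λ x → + 0 - a k * x) (cf-even k 0) ⟩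
  + 0 - a k * tc k 0          ≡⟨ cong (λ x → + 0 - x) (a-*-tc-zero k) ⟩
  tc (suc k) 0                ∎
cf-even (suc k) (suc j) = begin
  cf (suc k) (2 *ℕ suc j)
    ≡⟨ mulX+-mulX+-neg k (cf k) (2 *ℕ suc j) ⟩
  mulX (mulX (cf k)) (2 *ℕ suc j) - a k * cf k (2 *ℕ suc j)
    ≡⟨ cong₂ (λ x y → x - a k * y) (cong (mulX (mulX (cf k))) (ℕ.*-suc 2 j)) (cf-even k (suc j)) ⟩
  cf k (2 *ℕ j) - a k * tc k (suc j)
    ≡⟨ cong (λ x → x - a k * tc k (suc j)) (cf-even k j) ⟩
  tc (suc k) (suc j)
    ∎

dot-cf : ∀ m g → dot (suc (2 *ℕ m)) (cf m) g ≡ dot m (tc m) (λ j → g (2 *ℕ j))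
dot-cf m g = begin
  dot (suc (2 *ℕ m)) (cf m) g
    ≡⟨ sumTo-even+odd m _ ⟩
  dot m (λ j → cf m (2 *ℕ j)) (λ j → g (2 *ℕ j)) + odd-part
    ≡⟨ cong₂ _+_ (dot-congˡ m _ (cf-even m)) odd-part≡0 ⟩
  dot m (tc m) (λ j → g (2 *ℕ j)) + + 0
    ≡⟨ ℤ.+-identityʳ _ ⟩
  dot m (tc m) (λ j → g (2 *ℕ j))
    ∎
  where
  odd-part : ℤ
  odd-part = dot m (λ j → cf m (suc (2 *ℕ j))) (λ j → g (suc (2 *ℕ j)))
  odd-part≡0 : odd-part ≡ + 0
  odd-part≡0 = sumTo-zero m (λ j → cong (_* g (suc (2 *ℕ j))) (cf-odd m j))

cf/X-0 : ∀ k → cf/X k 0 ≡ + 0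
cf/X-0 zero    = refl
cf/X-0 (suc k) = begin
  cf/X (suc k) 0
    ≡⟨ mulX+-mulX+-neg (suc k) (cf/X k) 0 ⟩
  + 0 - a (suc k) * cf/X k 0
    ≡⟨ cong (λ x → + 0 - a (suc k) * x) (cf/X-0 k) ⟩
  + 0 - a (suc k) * + 0
    ≡⟨ cong (λ x → + 0 - x) (ℤ.*-zeroʳ (a (suc k))) ⟩
  + 0
    ∎

cf/X-1 : ∀ k → cf/X k 1 ≡ sgn k * + (k !) * + (k !)
cf/X-1 zero    = refl
cf/X-1 (suc k) = begin
  cf/X (suc k) 1
    ≡⟨ mulX+-mulX+-neg (suc k) (cf/X k) 1 ⟩
  + 0 - a (suc k) * cf/X k 1
    ≡⟨ cong₂ (λ x y → + 0 - x * y) (ℤ.pos-* (suc k) (suc k)) (cf/X-1 k) ⟩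
  + 0 - + suc k * + suc k * (sgn k * + (k !) * + (k !))
    ≡⟨ regroup (+ suc k) (sgn k) (+ (k !)) ⟩
  - sgn k * (+ suc k * + (k !)) * (+ suc k * + (k !))
    ≡⟨ cong (λ x → - sgn k * x * x) (ℤ.pos-* (suc k) (k !)) ⟨
  sgn (suc k) * + (suc k !) * + (suc k !)
    ∎
  where
  regroup : ∀ n s f → + 0 - n * n * (s * f * f) ≡ - s * (n * f) * (n * f)
  regroup = solve-∀

cf⁻-1 : ∀ k → cf⁻ (suc k) 1 ≡ sgn (suc k) * + (suc k !) * + (k !)
cf⁻-1 k = begin
  cf⁻ (suc k) 1
    ≡⟨ cf⁻-suc k 1 ⟩
  cf/X k 0 + - + suc k * cf/X k 1
    ≡⟨ cong₂ (λ x y → x + - + suc k * y) (cf/X-0 k) (cf/X-1 k) ⟩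
  + 0 + - + suc k * (sgn k * + (k !) * + (k !)) ≡⟨ regroup (+ suc k) (sgn k) (+ (k !)) ⟩
  - sgn k * (+ suc k * + (k !)) * + (k !)
    ≡⟨ cong (λ x → - sgn k * x * + (k !)) (ℤ.pos-* (suc k) (k !)) ⟨
  sgn (suc k) * + (suc k !) * + (k !)
    ∎
  where
  regroup : ∀ n s f → + 0 + - n * (s * f * f) ≡ - s * (n * f) * f
  regroup = solve-∀

dot-tc-double : ∀ g → IsGenocchiEGF g →
  ∀ k → dot (suc k) (tc (suc k)) (λ j → g (2 *ℕ j)) ≡ sgn (suc k) * + (suc k !) * + (k !)
dot-tc-double g egf k = begin
  dot m (tc m) (λ j → g (2 *ℕ j))  ≡⟨ dot-cf m g ⟨
  dot D (cf m) g                   ≡⟨ ℤ.*-cancelˡ-≡ (+ 2) _ _ twice ⟩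
  cf⁻ m 1                          ≡⟨ cf⁻-1 k ⟩
  sgn m * + (m !) * + (k !)        ∎
  where
  m D : ℕ
  m = suc k
  D = suc (2 *ℕ m)
  twice : + 2 * dot D (cf m) g ≡ + 2 * cf⁻ m 1
  twice = begin
    + 2 * dot D (cf m) g
      ≡⟨ dot-*ˡ D (+ 2) (cf m) g ⟨
    dot D (λ r → + 2 * cf m r) g
      ≡⟨ dot-congˡ D g (cf⁻-+-cf⁺ m) ⟨
    dot D (λ r → cf⁻ m r + cf⁺ m r) g
      ≡⟨ dot-+ˡ D (cf⁻ m) (cf⁺ m) g ⟩
    dot D (cf⁻ m) g + dot D (cf⁺ m) g
      ≡⟨ cong (λ x → dot D (cf⁻ m) g + x) (dot-congˡ D g (shift-cf⁻ (2 *ℕ m) m ℕ.≤-refl)) ⟨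
    dot D (cf⁻ m) g + dot D (shift D (cf⁻ m)) g
      ≡⟨ ℤ.+-comm (dot D (cf⁻ m) g) _ ⟩
    dot D (shift D (cf⁻ m)) g + dot D (cf⁻ m) g
      ≡⟨ dot-shift-+-dot g egf (2 *ℕ m) (cf⁻ m) ⟩
    + 2 * cf⁻ m 1
      ∎

tc-above : ∀ m j → m < j → tc m j ≡ + 0
tc-above zero    (suc j) _         = refl
tc-above (suc m) (suc j) (s≤s m<j) =
  trans (cong₂ (λ x y → x - a m * y) (tc-above m j m<j) (tc-above m (suc j) (ℕ.m<n⇒m<1+n m<j)))
        (cong (λ x → + 0 - x) (ℤ.*-zeroʳ (a m)))

Tc-above : ∀ m j → m < j → Tc m j ≡ + 0
Tc-above zero    (suc j) _         = refl
Tc-above (suc m) (suc j) (s≤s m<j) =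
  trans (cong₂ (λ x y → x + a (suc j) * y) (Tc-above m j m<j) (Tc-above m (suc j) (ℕ.m<n⇒m<1+n m<j)))
        (cong (λ x → + 0 + x) (ℤ.*-zeroʳ (a (suc j))))

dot-tc-suc : ∀ m h → dot (suc m) (tc (suc m)) h ≡ dot m (tc m) (h ∘ suc) - a m * dot m (tc m) h
dot-tc-suc m h = begin
  dot (suc m) (tc (suc m)) h
    ≡⟨ trans (sumTo-unfoldˡ m _) (ℤ.+-identityˡ _) ⟩
  sumTo m (λ j → (tc m j - a m * tc m (suc j)) * h (suc j))
    ≡⟨ sumTo-cong m (λ j → split (tc m j) (a m) (tc m (suc j)) (h (suc j))) ⟩
  sumTo m (λ j → tc m j * h (suc j) + ψ (suc j))
    ≡⟨ sumTo-+ m _ _ ⟩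
  dot m (tc m) (h ∘ suc) + sumTo m (ψ ∘ suc)
    ≡⟨ cong (λ x → dot m (tc m) (h ∘ suc) + x) (sumTo-∘suc m ψ ψ0≡0 ψ[1+m]≡0) ⟩
  dot m (tc m) (h ∘ suc) + sumTo m ψ
    ≡⟨ cong (λ x → dot m (tc m) (h ∘ suc) + x) (sumTo-*ˡ m (- a m) _) ⟩
  dot m (tc m) (h ∘ suc) + - a m * dot m (tc m) h
    ≡⟨ cong (λ x → dot m (tc m) (h ∘ suc) + x) (ℤ.neg-distribˡ-* (a m) _) ⟨
  dot m (tc m) (h ∘ suc) - a m * dot m (tc m) h
    ∎
  where
  ψ : ℕ → ℤ
  ψ j = - a m * (tc m j * h j)
  split : ∀ x c y z → (x - c * y) * z ≡ x * z + - c * (y * z)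
  split = solve-∀
  ψ0≡0 : ψ 0 ≡ + 0
  ψ0≡0 = begin
    - a m * (tc m 0 * h 0)   ≡⟨ ℤ.*-assoc (- a m) (tc m 0) (h 0) ⟨
    - a m * tc m 0 * h 0     ≡⟨ cong (_* h 0) (ℤ.neg-distribˡ-* (a m) (tc m 0)) ⟨
    - (a m * tc m 0) * h 0   ≡⟨ cong (λ x → - x * h 0) (a-*-tc-zero m) ⟩
    + 0                      ∎
  ψ[1+m]≡0 : ψ (suc m) ≡ + 0
  ψ[1+m]≡0 = trans (cong (λ x → - a m * (x * h (suc m))) (tc-above m (suc m) ℕ.≤-refl))
                   (ℤ.*-zeroʳ (- a m))

dot-Tc-suc : ∀ n u → dot (suc n) (Tc (suc n)) u ≡ dot n (Tc n) (λ j → u (suc j) + a j * u j)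
dot-Tc-suc n u = begin
  dot (suc n) (Tc (suc n)) u
    ≡⟨ trans (sumTo-unfoldˡ n _) (ℤ.+-identityˡ _) ⟩
  sumTo n (λ j → (Tc n j + a (suc j) * Tc n (suc j)) * u (suc j))
    ≡⟨ sumTo-cong n (λ j → split (Tc n j) (a (suc j)) (Tc n (suc j)) (u (suc j))) ⟩
  sumTo n (λ j → Tc n j * u (suc j) + φ (suc j))
    ≡⟨ sumTo-+ n _ _ ⟩
  dot n (Tc n) (u ∘ suc) + sumTo n (φ ∘ suc)
    ≡⟨ cong (λ x → dot n (Tc n) (u ∘ suc) + x) (sumTo-∘suc n φ (ℤ.*-zeroʳ (Tc n 0)) φ[1+n]≡0) ⟩
  dot n (Tc n) (u ∘ suc) + dot n (Tc n) (λ j → a j * u j)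
    ≡⟨ dot-+ʳ n (Tc n) _ _ ⟨
  dot n (Tc n) (λ j → u (suc j) + a j * u j)
    ∎
  where
  φ : ℕ → ℤ
  φ j = Tc n j * (a j * u j)
  split : ∀ x c y z → (x + c * y) * z ≡ x * z + y * (c * z)
  split = solve-∀
  φ[1+n]≡0 : φ (suc n) ≡ + 0
  φ[1+n]≡0 = cong (_* (a (suc n) * u (suc n))) (Tc-above n (suc n) ℕ.≤-refl)

[m-j][j+m]!≡[m²-j²][j+m-1]! : ∀ m j →
  (+ m - + j) * + ((j +ℕ m) !) ≡ (+ m * + m - + j * + j) * + ((j +ℕ m ∸ 1) !)
[m-j][j+m]!≡[m²-j²][j+m-1]! m j with j +ℕ m in eq
... | zero rewrite ℕ.m+n≡0⇒m≡0 j eq | ℕ.m+n≡0⇒n≡0 j eq = refl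
... | suc k = begin
  (+ m - + j) * + (suc k !)               ≡⟨ cong ((+ m - + j) *_) (ℤ.pos-* (suc k) (k !)) ⟩
  (+ m - + j) * (+ suc k * + (k !))       ≡⟨ cong (λ x → (+ m - + j) * (x * + (k !))) 1+k≡j+m ⟩
  (+ m - + j) * ((+ j + + m) * + (k !))   ≡⟨ difference-of-squares (+ m) (+ j) (+ (k !)) ⟩
  (+ m * + m - + j * + j) * + (k !)       ∎
  where
  1+k≡j+m : + suc k ≡ + j + + m
  1+k≡j+m = trans (cong +_ (sym eq)) (ℤ.pos-+ j m)
  difference-of-squares : ∀ x y z → (x - y) * ((y + x) * z) ≡ (x * x - y * y) * z
  difference-of-squares = solve-∀

centralWeight : ℕ → ℕ → ℤ
centralWeight m j = sgn (m +ℕ j) * + (m !) * + (j !) * + ((j +ℕ m ∸ 1) !)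

centralWeight-suc : ∀ m j →
  centralWeight m (suc j) + a j * centralWeight m j ≡ centralWeight (suc m) j + a m * centralWeight m j
centralWeight-suc m j = begin
  centralWeight m (suc j) + a j * centralWeight m j
    ≡⟨ cong₂ _+_ weight-at-1+j (cong (_* centralWeight m j) (ℤ.pos-* j j)) ⟩
  - s * M * ((+ 1 + + j) * J) * F + + j * + j * (s * M * J * F′)
    ≡⟨ expand s M J F F′ (+ m) (+ j) ⟩
  - s * ((+ 1 + + m) * M) * J * F + + m * + m * (s * M * J * F′)
    + s * M * J * ((+ m - + j) * F - (+ m * + m - + j * + j) * F′)
    ≡⟨ cong (λ d → - s * ((+ 1 + + m) * M) * J * F + + m * + m * (s * M * J * F′) + s * M * J * d)
            (ℤ.i≡j⇒i-j≡0 ([m-j][j+m]!≡[m²-j²][j+m-1]! m j)) ⟩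
  - s * ((+ 1 + + m) * M) * J * F + + m * + m * (s * M * J * F′) + s * M * J * + 0
    ≡⟨ drop-zero _ (s * M * J) ⟩
  - s * ((+ 1 + + m) * M) * J * F + + m * + m * (s * M * J * F′)
    ≡⟨ cong₂ _+_ weight-at-1+m (cong (_* centralWeight m j) (ℤ.pos-* m m)) ⟨
  centralWeight (suc m) j + a m * centralWeight m j
    ∎
  where
  s M J F F′ : ℤ
  s = sgn (m +ℕ j)
  M = + (m !)
  J = + (j !)
  F = + ((j +ℕ m) !)
  F′ = + ((j +ℕ m ∸ 1) !)
  weight-at-1+j : centralWeight m (suc j) ≡ - s * M * ((+ 1 + + j) * J) * F
  weight-at-1+j = cong₂ (λ σ x → σ * M * x * F) (cong sgn (ℕ.+-suc m j))
                        (trans (ℤ.pos-* (suc j) (j !)) (cong (_* J) (ℤ.pos-+ 1 j)))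
  weight-at-1+m : centralWeight (suc m) j ≡ - s * ((+ 1 + + m) * M) * J * F
  weight-at-1+m = cong₂ (λ x i → - s * x * J * + (i !))
                        (trans (ℤ.pos-* (suc m) (m !)) (cong (_* M) (ℤ.pos-+ 1 m)))
                        (cong (_∸ 1) (ℕ.+-suc j m))
  expand : ∀ s M J F F′ m j →
    - s * M * ((+ 1 + j) * J) * F + j * j * (s * M * J * F′) ≡
    - s * ((+ 1 + m) * M) * J * F + m * m * (s * M * J * F′) + s * M * J * ((m - j) * F - (m * m - j * j) * F′)
  expand = solve-∀
  drop-zero : ∀ x y → x + y * + 0 ≡ x
  drop-zero = solve-∀

CentralRecurrence : (ℕ → ℕ → ℤ) → Set
CentralRecurrence f = ∀ m n → f m (suc n) ≡ f (suc m) n + a m * f m n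

central-recurrence-unique : ∀ {f f′} → CentralRecurrence f → CentralRecurrence f′ →
  (∀ m → f (suc m) 0 ≡ f′ (suc m) 0) → ∀ m n → f m (suc n) ≡ f′ m (suc n)
central-recurrence-unique {f} {f′} rec rec′ base m n =
  trans (rec m n) (trans (cong₂ _+_ (agree n m) (scaled-agree m n)) (sym (rec′ m n)))
  where
  agree : ∀ n m → f (suc m) n ≡ f′ (suc m) n
  agree zero    m = base m
  agree (suc n) m = begin
    f (suc m) (suc n)
      ≡⟨ rec (suc m) n ⟩
    f (suc (suc m)) n + a (suc m) * f (suc m) n
      ≡⟨ cong₂ (λ x y → x + a (suc m) * y) (agree n (suc m)) (agree n m) ⟩
    f′ (suc (suc m)) n + a (suc m) * f′ (suc m) n
      ≡⟨ rec′ (suc m) n ⟨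
    f′ (suc m) (suc n)
      ∎
  scaled-agree : ∀ m n → a m * f m n ≡ a m * f′ m n
  scaled-agree zero    n = refl
  scaled-agree (suc m) n = cong (a (suc m) *_) (agree n m)

genocchiSide : (ℕ → ℤ) → ℕ → ℕ → ℤ
genocchiSide g m n = dot m (tc m) (λ j → g (2 *ℕ n +ℕ 2 *ℕ j))

factorialSide : ℕ → ℕ → ℤ
factorialSide m n = dot n (Tc n) (centralWeight m)

genocchiSide-recurrence : ∀ g → CentralRecurrence (genocchiSide g)
genocchiSide-recurrence g m n = begin
  genocchiSide g m (suc n)
    ≡⟨ dot-congʳ m (tc m) (λ j → cong g (index n j)) ⟩
  dot m (tc m) (h ∘ suc)
    ≡⟨ x≡x-y+y (dot m (tc m) (h ∘ suc)) (a m * genocchiSide g m n) ⟩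
  dot m (tc m) (h ∘ suc) - a m * genocchiSide g m n + a m * genocchiSide g m n
    ≡⟨ cong (_+ a m * genocchiSide g m n) (dot-tc-suc m h) ⟨
  genocchiSide g (suc m) n + a m * genocchiSide g m n
    ∎
  where
  h : ℕ → ℤ
  h j = g (2 *ℕ n +ℕ 2 *ℕ j)
  index : ∀ k i → 2 *ℕ suc k +ℕ 2 *ℕ i ≡ 2 *ℕ k +ℕ 2 *ℕ suc i
  index = ℕ-Ring.solve-∀
  x≡x-y+y : ∀ x y → x ≡ x - y + y
  x≡x-y+y = solve-∀

factorialSide-recurrence : CentralRecurrence factorialSide
factorialSide-recurrence m n = begin
  dot (suc n) (Tc (suc n)) (centralWeight m)
    ≡⟨ dot-Tc-suc n (centralWeight m) ⟩
  dot n (Tc n) (λ j → centralWeight m (suc j) + a j * centralWeight m j)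
    ≡⟨ dot-congʳ n (Tc n) (centralWeight-suc m) ⟩
  dot n (Tc n) (λ j → centralWeight (suc m) j + a m * centralWeight m j)
    ≡⟨ dot-+ʳ n (Tc n) _ _ ⟩
  factorialSide (suc m) n + dot n (Tc n) (λ j → a m * centralWeight m j)
    ≡⟨ cong (λ x → factorialSide (suc m) n + x) (dot-*ʳ n (a m) (Tc n) (centralWeight m)) ⟩
  factorialSide (suc m) n + a m * factorialSide m n
    ∎

sides-agree-at-0 : ∀ g → IsGenocchiEGF g → ∀ m → genocchiSide g (suc m) 0 ≡ factorialSide (suc m) 0
sides-agree-at-0 g egf m = begin
  genocchiSide g (suc m) 0
    ≡⟨ dot-tc-double g egf m ⟩
  sgn (suc m) * + (suc m !) * + (m !)
    ≡⟨ cong (λ i → sgn i * + (suc m !) * + (m !)) (ℕ.+-identityʳ (suc m)) ⟨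
  sgn (suc m +ℕ 0) * + (suc m !) * + (m !)
    ≡⟨ insert-ones (sgn (suc m +ℕ 0)) (+ (suc m !)) (+ (m !)) ⟩
  factorialSide (suc m) 0
    ∎
  where
  insert-ones : ∀ s x y → s * x * y ≡ + 1 * (s * x * + 1 * y)
  insert-ones = solve-∀

genocchi-even : ∀ g n j → genocchi g (2 *ℕ n +ℕ 2 *ℕ j) ≡ sgn (n +ℕ j) * g (2 *ℕ n +ℕ 2 *ℕ j)
genocchi-even g n j = cong (λ k → sgn k * g (2 *ℕ n +ℕ 2 *ℕ j)) half
  where
  half : (2 *ℕ n +ℕ 2 *ℕ j) / 2 ≡ n +ℕ j
  half = trans (cong (_/ 2) (trans (sym (ℕ.*-distribˡ-+ 2 n j)) (ℕ.*-comm 2 (n +ℕ j))))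
               (m*n/n≡m (n +ℕ j) 2)

genocchi-summand : ∀ g m n j → sgn (m +ℕ j) * tc m j * genocchi g (2 *ℕ n +ℕ 2 *ℕ j)
                                 ≡ sgn (m +ℕ n) * (tc m j * g (2 *ℕ n +ℕ 2 *ℕ j))
genocchi-summand g m n j = begin
  sgn (m +ℕ j) * t * genocchi g (2 *ℕ n +ℕ 2 *ℕ j)
    ≡⟨ cong (sgn (m +ℕ j) * t *_) (genocchi-even g n j) ⟩
  sgn (m +ℕ j) * t * (sgn (n +ℕ j) * G)
    ≡⟨ regroup (sgn (m +ℕ j)) (sgn (n +ℕ j)) t G ⟩
  sgn (m +ℕ j) * sgn (n +ℕ j) * (t * G)
    ≡⟨ cong₂ (λ x y → sgn x * sgn y * (t * G)) (ℕ.+-comm m j) (ℕ.+-comm n j) ⟩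
  sgn (j +ℕ m) * sgn (j +ℕ n) * (t * G)
    ≡⟨ cong (_* (t * G)) (sgn-+-*-sgn-+ j m n) ⟩
  sgn (m +ℕ n) * (t * G)
    ∎
  where
  t G : ℤ
  t = tc m j
  G = g (2 *ℕ n +ℕ 2 *ℕ j)
  regroup : ∀ s s′ t G → s * t * (s′ * G) ≡ s * s′ * (t * G)
  regroup = solve-∀

factorial-summand : ∀ m n j → sgn (m +ℕ n) * (Tc n j * centralWeight m j)
                              ≡ + (m !) * (sgn (n +ℕ j) * Tc n j * + (j !) * + ((j +ℕ m ∸ 1) !))
factorial-summand m n j =
  trans (regroup (sgn (m +ℕ n)) (sgn (m +ℕ j)) (Tc n j) (+ (m !)) (+ (j !)) (+ ((j +ℕ m ∸ 1) !)))
        (cong (λ s → + (m !) * (s * Tc n j * + (j !) * + ((j +ℕ m ∸ 1) !))) (sgn-+-*-sgn-+ m n j))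
  where
  regroup : ∀ s s′ T M J Q → s * (T * (s′ * M * J * Q)) ≡ M * (s * s′ * T * J * Q)
  regroup = solve-∀

proposition2 : (g : ℕ → ℤ) → IsGenocchiEGF g → (m n : ℕ) → 1 ≤ n →
    sumTo m (λ j → sgn (m +ℕ j) * tc m j * genocchi g (2 *ℕ n +ℕ 2 *ℕ j))
      ≡ + (m !) * sumTo n (λ j → sgn (n +ℕ j) * Tc n j * + (j !) * + ((j +ℕ m ∸ 1) !))
proposition2 g egf m zero    ()
proposition2 g egf m (suc n) _ = begin
  sumTo m (λ j → sgn (m +ℕ j) * tc m j * genocchi g (2 *ℕ N +ℕ 2 *ℕ j))
    ≡⟨ sumTo-cong m (genocchi-summand g m N) ⟩
  sumTo m (λ j → σ * (tc m j * g (2 *ℕ N +ℕ 2 *ℕ j)))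
    ≡⟨ sumTo-*ˡ m σ _ ⟩
  σ * genocchiSide g m N
    ≡⟨ cong (σ *_) (central-recurrence-unique {genocchiSide g} {factorialSide}
                      (genocchiSide-recurrence g) factorialSide-recurrence (sides-agree-at-0 g egf) m n) ⟩
  σ * factorialSide m N
    ≡⟨ sumTo-*ˡ N σ _ ⟨
  sumTo N (λ j → σ * (Tc N j * centralWeight m j))
    ≡⟨ sumTo-cong N (factorial-summand m N) ⟩
  sumTo N (λ j → + (m !) * (sgn (N +ℕ j) * Tc N j * + (j !) * + ((j +ℕ m ∸ 1) !)))
    ≡⟨ sumTo-*ˡ N (+ (m !)) _ ⟩
  + (m !) * sumTo N (λ j → sgn (N +ℕ j) * Tc N j * + (j !) * + ((j +ℕ m ∸ 1) !))
    ∎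
  where
  N : ℕ
  N = suc n
  σ : ℤ
  σ = sgn (m +ℕ N)
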